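{- Let $S$ be a set and $\to\subseteq S\times S$ a binary relation. For every $Q\subseteq S$ and every $n\in\mathbb{N}$, we have $\mathrm{EvN}_{\to}(n,Q)\subseteq \mathrm{Ev}_{\to}(Q)$.
   Context: $S$ is a set of (machine) states and $\to$ a (possibly nondeterministic) small-step transition relation. For $n\in\mathbb{N}$, $\to^n$ denotes the $n$-fold composition of $\to$, with $\to^0$ the identity relation on $S$. For $Q\subseteq S$, $\mathrm{Ev}_{\to}(Q)\subseteq S$ is the least set closed under the two rules: (1) if $s\in Q$ then $s\in\mathrm{Ev}_{\to}(Q)$; (2) if there exists $s'$ with $s\to s'$, and every $s'$ with $s\to s'$ lies in $\mathrm{Ev}_{\to}(Q)$, then $s\in\mathrm{Ev}_{\to}(Q)$. For $n\in\mathbb{N}$ and $Q\subseteq S$, $\mathrm{EvN}_{\to}(n,Q)=\{s\in S\mid (\forall s'.\ s\to^n s'\Rightarrow s'\in Q)\ \wedge\ (\forall s'\,\forall l\in\mathbb{N}.\ l<n\wedge s\to^l s'\Rightarrow\exists s''.\ s'\to s'')\}$. -}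

module Defs where

open import Level using (Level; _⊔_; suc; Lift)
open import Data.Nat using (ℕ; zero; suc; _<_)
open import Data.Product using (∃; Σ; _×_; _,_)
open import Relation.Binary.PropositionalEquality using (_≡_)
open import Relation.Unary using (Pred)

private variable
  a ℓ q : Level

Rel : Set a → (ℓ : Level) → Set (a ⊔ Level.suc ℓ)
Rel S ℓ = S → S → Set ℓ

_^[_] : {a ℓ : Level} {S : Set a} → Rel S ℓ → ℕ → Rel S (a ⊔ ℓ)
_^[_] {ℓ = ℓ} _⟶_ zero s t = Lift ℓ (s ≡ t)
_^[_] _⟶_ (suc n) s t = ∃ λ u → (s ⟶ u) × (_⟶_ ^[ n ]) u t

data Ev {S : Set a} (_⟶_ : Rel S ℓ) (Q : Pred S q) : Pred S (a ⊔ ℓ ⊔ q) where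
  now  : ∀ {s} → Q s → Ev _⟶_ Q s
  step : ∀ {s} → (∃ λ s′ → s ⟶ s′) → (∀ s′ → s ⟶ s′ → Ev _⟶_ Q s′) → Ev _⟶_ Q s

EvN : {S : Set a} → Rel S ℓ → ℕ → Pred S q → Pred S (a ⊔ ℓ ⊔ q)
EvN {S = S} _⟶_ n Q s =
  (∀ s′ → (_⟶_ ^[ n ]) s s′ → Q s′)
  × (∀ s′ (l : ℕ) → l < n → (_⟶_ ^[ l ]) s s′ → ∃ λ s″ → s′ ⟶ s″)

{-# OPTIONS --safe #-}
module Submission where

open import Defs
open import Level using (Level; lift)
open import Data.Nat using (ℕ; zero; suc; s≤s; z≤n)
open import Data.Product using (∃; _,_)
open import Relation.Binary.PropositionalEquality using (refl)
open import Relation.Unary using (Pred; _⊆_)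

module _ {a ℓ q : Level} {S : Set a} {_⟶_ : Rel S ℓ} {Q : Pred S q} where

  EvN-suc⇒∃step : ∀ {n s} → EvN _⟶_ (suc n) Q s → ∃ λ s′ → s ⟶ s′
  EvN-suc⇒∃step {s = s} (_ , progress) = progress s zero (s≤s z≤n) (lift refl)

  EvN-suc-step : ∀ {n s s′} → EvN _⟶_ (suc n) Q s → s ⟶ s′ → EvN _⟶_ n Q s′
  EvN-suc-step {s′ = s′} (reach , progress) s⟶s′ =
    (λ t s′⟶ⁿt → reach t (s′ , s⟶s′ , s′⟶ⁿt)) ,
    (λ t l l<n s′⟶ˡt → progress t (suc l) (s≤s l<n) (s′ , s⟶s′ , s′⟶ˡt))

lemma1 : {a ℓ q : Level} {S : Set a} (_⟶_ : Rel S ℓ) (Q : Pred S q) (n : ℕ) →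
    EvN _⟶_ n Q ⊆ Ev _⟶_ Q
lemma1 _⟶_ Q zero {s} (reach , _) = now (reach s (lift refl))
lemma1 _⟶_ Q (suc n) h =
  step (EvN-suc⇒∃step h) (λ _ s⟶s′ → lemma1 _⟶_ Q n (EvN-suc-step h s⟶s′))
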